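{- Let $G$ be a Helly graph and $v\in V(G)$, and let $G+\{u\}$ be the graph obtained by adding a new vertex $u$ as a false twin of $v$ (i.e., $u$ is adjacent exactly to the vertices of $N(v)$, and not to $v$). If there is a vertex $y\in V(G)$ with $y\ne v$ and $N[v]\subseteq N[y]$, then $G+\{u\}$ is Helly.
   Context: Graphs are finite, connected, simple, with shortest-path metric. $N(v)$ is the open and $N[v]=N(v)\cup\{v\}$ the closed neighborhood. A graph is Helly if every family of pairwise intersecting disks $D(v,r)=\{u:d(u,v)\le r\}$ has a common vertex. -}

module Defs where

open import Data.Nat using (ℕ; zero; suc)
open import Data.Fin using (Fin; zero; suc)
open import Data.Product using (Σ; _×_; _,_; ∃)
open import Data.Sum using (_⊎_)
open import Data.Empty using (⊥)
open import Data.List using (List)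
open import Data.List.Membership.Propositional using (_∈_)
open import Relation.Binary.PropositionalEquality using (_≡_; refl)
open import Relation.Nullary using (¬_)

record Graph : Set₁ where
  field
    n     : ℕ
    Adj   : Fin n → Fin n → Set
    adjSym : ∀ {a b} → Adj a b → Adj b a
    irrefl : ∀ {a} → ¬ Adj a a
open Graph public

-- Within G r a b  ⇔  d_G(a,b) ≤ r  (there is a walk of length ≤ r from a to b).
data Within (G : Graph) : ℕ → Fin (n G) → Fin (n G) → Set where
  here : ∀ {r a} → Within G r a a
  step : ∀ {r a b c} → Adj G a b → Within G r b c → Within G (suc r) a c

Connected : Graph → Set
Connected G = ∀ a b → ∃ λ r → Within G r a b

-- A disk D(c, r) is given by its centre and radius.
Disk : Graph → Set
Disk G = Fin (n G) × ℕ

_∈D_ : {G : Graph} → Fin (n G) → Disk G → Set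
_∈D_ {G} x (c , r) = Within G r c x

Helly : Graph → Set
Helly G = (F : List (Disk G)) →
  (∀ {D₁ D₂} → D₁ ∈ F → D₂ ∈ F → Σ (Fin (n G)) λ x → _∈D_ {G} x D₁ × _∈D_ {G} x D₂) →
  Σ (Fin (n G)) λ x → ∀ {D} → D ∈ F → _∈D_ {G} x D

InClosedNbhd : (G : Graph) → Fin (n G) → Fin (n G) → Set
InClosedNbhd G v w = (w ≡ v) ⊎ Adj G v w

-- G + {u}: add a new vertex u (= zero) as a false twin of v; old vertex i becomes suc i.
twinAdj : (G : Graph) → Fin (n G) → Fin (suc (n G)) → Fin (suc (n G)) → Set
twinAdj G v zero    zero    = ⊥
twinAdj G v zero    (suc j) = Adj G v j
twinAdj G v (suc i) zero    = Adj G i v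
twinAdj G v (suc i) (suc j) = Adj G i j

twinSym : (G : Graph) (v : Fin (n G)) → ∀ {a b} → twinAdj G v a b → twinAdj G v b a
twinSym G v {zero}  {zero}  ()
twinSym G v {zero}  {suc j} p = Graph.adjSym G p
twinSym G v {suc i} {zero}  p = Graph.adjSym G p
twinSym G v {suc i} {suc j} p = Graph.adjSym G p

twinIrrefl : (G : Graph) (v : Fin (n G)) → ∀ {a} → ¬ twinAdj G v a a
twinIrrefl G v {zero}  ()
twinIrrefl G v {suc i} p = Graph.irrefl G p

addFalseTwin : (G : Graph) → Fin (n G) → Graph
addFalseTwin G v = record
  { n = suc (n G)
  ; Adj = twinAdj G v
  ; adjSym = λ {a} {b} → twinSym G v {a} {b}
  ; irrefl = λ {a} → twinIrrefl G v {a}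
  }

module Submission where

-- Write G⁺ = G + {u} and fold G⁺ onto G by sending the twin u
-- to v; this map preserves adjacency, so walks of G⁺ project to walks of G,
-- while walks of G lift to G⁺ along the inclusion.  The dominating vertex y
-- (N[v] ⊆ N[y], y ≠ v) is a neighbour of v, so u–y–v is a walk of length 2,
-- and any walk leaving v towards a vertex c ≠ v may start at y instead.
--   * Connectivity: old pairs are joined by lifted walks, u reaches v in two
--     steps, and u reaches any other x by copying a v–x walk of G.
--   * Helly: let F be a pairwise intersecting family of disks of G⁺.  If the
--     point disk D(u,0) belongs to F, then u is common to all disks.  Otherwise
--     fold F into G and take a common vertex x given by Helly G.  If x ≠ v,
--     the old copy of x is common; if x = v, the old copy of v is common unless
--     D(u,1) ∈ F, and in that case y is common (D(v,0) cannot occur then, since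
--     it would miss D(u,1)).

open import Defs
open import Data.Nat using (zero; suc)
import Data.Nat as ℕ
open import Data.Fin using (Fin; zero; suc)
import Data.Fin as Fin
open import Data.Product using (_×_; _,_; Σ)
open import Data.Product.Properties using (≡-dec)
open import Data.Sum using (inj₁; inj₂)
open import Data.Empty using (⊥-elim)
open import Data.List using (List; map)
open import Data.List.Membership.Propositional using (_∈_; _∉_)
open import Data.List.Membership.Propositional.Properties using (∈-map⁺; ∈-map⁻)
import Data.List.Membership.DecPropositional as DecMembership
open import Relation.Binary.PropositionalEquality using (_≡_; refl; sym; subst)
open import Relation.Nullary using (¬_; Dec; yes; no)

PairwiseIntersecting : (G : Graph) → List (Disk G) → Set
PairwiseIntersecting G F = ∀ {D₁ D₂} → D₁ ∈ F → D₂ ∈ F →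
  Σ (Fin (n G)) λ x → _∈D_ {G} x D₁ × _∈D_ {G} x D₂

CommonPoint : (G : Graph) → List (Disk G) → Fin (n G) → Set
CommonPoint G F x = ∀ {D} → D ∈ F → _∈D_ {G} x D

module Walks (G : Graph) where

  widen : ∀ {r a b} → Within G r a b → Within G (suc r) a b
  widen here       = here
  widen (step e w) = step e (widen w)

  snoc : ∀ {r a b c} → Within G r a b → Adj G b c → Within G (suc r) a c
  snoc here        e = step e here
  snoc (step e' w) e = step e' (snoc w e)

  reverse : ∀ {r a b} → Within G r a b → Within G r b a
  reverse here       = here
  reverse (step e w) = snoc (reverse w) (adjSym G e)

  within0⇒≡ : ∀ {a b} → Within G 0 a b → a ≡ b
  within0⇒≡ here = refl

module FalseTwin (G : Graph) (v : Fin (n G)) where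

  G⁺ : Graph
  G⁺ = addFalseTwin G v

  u : Fin (n G⁺)
  u = zero

  fold : Fin (n G⁺) → Fin (n G)
  fold zero    = v
  fold (suc i) = i

  fold-adj : ∀ a b → Adj G⁺ a b → Adj G (fold a) (fold b)
  fold-adj zero    zero    ()
  fold-adj zero    (suc j) e = e
  fold-adj (suc i) zero    e = e
  fold-adj (suc i) (suc j) e = e

  project : ∀ {r a b} → Within G⁺ r a b → Within G r (fold a) (fold b)
  project here = here
  project (step {a = a} {b = b} e w) = step (fold-adj a b e) (project w)

  embed : ∀ {r a b} → Within G r a b → Within G⁺ r (suc a) (suc b)
  embed here       = here
  embed (step e w) = step e (embed w)

  -- u has the neighbours of v, so u copies every walk from v to x ≠ v.
  from-twin : ∀ {r x} → ¬ x ≡ v → Within G r v x → Within G⁺ r u (suc x)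
  from-twin x≢v here       = ⊥-elim (x≢v refl)
  from-twin x≢v (step e w) = step e (embed w)

  twin-far : ¬ Within G⁺ 1 u (suc v)
  twin-far (step e here) = irrefl G e

  foldDisk : Disk G⁺ → Disk G
  foldDisk (c , r) = fold c , r

  fold-pairwise : ∀ {F} → PairwiseIntersecting G⁺ F → PairwiseIntersecting G (map foldDisk F)
  fold-pairwise pw D₁∈ D₂∈ with ∈-map⁻ foldDisk D₁∈ | ∈-map⁻ foldDisk D₂∈
  ... | _ , m₁ , refl | _ , m₂ , refl with pw m₁ m₂
  ... | z , z∈D₁ , z∈D₂ = fold z , project z∈D₁ , project z∈D₂

  FoldedCommon : List (Disk G⁺) → Fin (n G) → Set
  FoldedCommon F x = ∀ {c r} → (c , r) ∈ F → Within G r (fold c) x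

  fold-common : ∀ {F x} → CommonPoint G (map foldDisk F) x → FoldedCommon F x
  fold-common common D∈ = common (∈-map⁺ foldDisk D∈)

  common-away : ∀ {F x} → ¬ x ≡ v → FoldedCommon F x → CommonPoint G⁺ F (suc x)
  common-away {x = x} x≢v common {c , r} D∈ = unfold c (common D∈)
    where
    unfold : ∀ c → Within G r (fold c) x → Within G⁺ r c (suc x)
    unfold zero    w = from-twin x≢v w
    unfold (suc c) w = embed w

  _≟D_ : (D₁ D₂ : Disk G⁺) → Dec (D₁ ≡ D₂)
  _≟D_ = ≡-dec Fin._≟_ ℕ._≟_

  open DecMembership _≟D_ using (_∈?_) public

  -- If the point disk {u} belongs to a pairwise intersecting family, every
  -- disk of the family meets it, i.e. contains u.
  common-point-disk : ∀ {F} → PairwiseIntersecting G⁺ F → (u , 0) ∈ F → CommonPoint G⁺ F u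
  common-point-disk pw u0∈ D∈ with pw u0∈ D∈
  ... | z , u∈z , z∈D = subst (Within G⁺ _ _) (sym (Walks.within0⇒≡ G⁺ u∈z)) z∈D

module Dominated (G : Graph) (v y : Fin (n G)) (y≢v : ¬ y ≡ v)
                 (dominates : ∀ w → InClosedNbhd G v w → InClosedNbhd G y w) where

  open FalseTwin G v

  -- v ∈ N[y] and y ≠ v, so y is a neighbour of v.
  y~v : Adj G y v
  y~v with dominates v (inj₁ refl)
  ... | inj₁ v≡y = ⊥-elim (y≢v (sym v≡y))
  ... | inj₂ e   = e

  v~y : Adj G v y
  v~y = adjSym G y~v

  -- A walk from v to c ≠ v can start at y instead: its first step goes into
  -- N(v) ⊆ N[y].
  reroute : ∀ {r c} → ¬ c ≡ v → Within G r v c → Within G r y c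
  reroute c≢v here = ⊥-elim (c≢v refl)
  reroute c≢v (step {b = b} e w) with dominates b (inj₂ e)
  ... | inj₁ refl = Walks.widen G w
  ... | inj₂ e'   = step e' w

  twin-to-v : ∀ {r} → Within G⁺ (suc (suc r)) u (suc v)
  twin-to-v = step {b = suc y} v~y (step y~v here)

  connected : Connected G → Connected G⁺
  connected conn zero zero = 0 , here
  connected conn zero (suc b) with b Fin.≟ v | conn v b
  ... | yes refl | _     = 2 , twin-to-v
  ... | no b≢v   | r , w = r , from-twin b≢v w
  connected conn (suc a) zero with connected conn zero (suc a)
  ... | r , w = r , Walks.reverse G⁺ w
  connected conn (suc a) (suc b) with conn a b
  ... | r , w = r , embed w

  -- Case x = v without D(u,1): all disks around u have radius ≥ 2 and so
  -- contain v, and the other disks contain v already in G.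
  common-v : ∀ {F} → (u , 0) ∉ F → (u , 1) ∉ F → FoldedCommon F v → CommonPoint G⁺ F (suc v)
  common-v {F} u0∉ u1∉ common {c , r} D∈ = unfold c r D∈ (common D∈)
    where
    unfold : ∀ c r → (c , r) ∈ F → Within G r (fold c) v → Within G⁺ r c (suc v)
    unfold zero    zero          D∈ _ = ⊥-elim (u0∉ D∈)
    unfold zero    (suc zero)    D∈ _ = ⊥-elim (u1∉ D∈)
    unfold zero    (suc (suc r)) D∈ _ = twin-to-v
    unfold (suc c) r             D∈ w = embed w

  -- Disks of positive radius
  -- centred at u or v contain their neighbour y, other disks reach v and
  -- hence y by rerouting, and D(v,0) would miss D(u,1).
  common-y : ∀ {F} → PairwiseIntersecting G⁺ F → (u , 0) ∉ F → (u , 1) ∈ F →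
             FoldedCommon F v → CommonPoint G⁺ F (suc y)
  common-y {F} pw u0∉ u1∈ common {c , r} D∈ = unfold c r D∈ (common D∈)
    where
    unfold : ∀ c r → (c , r) ∈ F → Within G r (fold c) v → Within G⁺ r c (suc y)
    unfold zero    zero    D∈ _ = ⊥-elim (u0∉ D∈)
    unfold zero    (suc r) D∈ _ = step v~y here
    unfold (suc c) r       D∈ w with c Fin.≟ v
    unfold (suc c) r       D∈ w | no c≢v = embed (Walks.reverse G (reroute c≢v (Walks.reverse G w)))
    unfold (suc c) (suc r) D∈ w | yes refl = step v~y here
    unfold (suc c) zero    D∈ w | yes refl with pw D∈ u1∈
    ... | z , v∈z , z∈U = ⊥-elim (twin-far (subst (Within G⁺ 1 u) (sym (Walks.within0⇒≡ G⁺ v∈z)) z∈U))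

  helly : Helly G → Helly G⁺
  helly hG F pw with (u , 0) ∈? F
  ... | yes u0∈ = u , common-point-disk pw u0∈
  ... | no u0∉ with hG (map foldDisk F) (fold-pairwise pw)
  ... | x , common with x Fin.≟ v
  ... | no x≢v = suc x , common-away x≢v (fold-common common)
  ... | yes refl with (u , 1) ∈? F
  ... | no u1∉  = suc v , common-v u0∉ u1∉ (fold-common common)
  ... | yes u1∈ = suc y , common-y pw u0∉ u1∈ (fold-common common)

lemma14 : (G : Graph) → Connected G → Helly G → (v y : Fin (n G)) → ¬ (y ≡ v) →
    (∀ w → InClosedNbhd G v w → InClosedNbhd G y w) →
    Connected (addFalseTwin G v) × Helly (addFalseTwin G v)
lemma14 G conn hG v y y≢v dominates = connected conn , helly hG
  where open Dominated G v y y≢v dominates
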